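{- Let $A$ be a circular $m\times n$ matrix. Then for every circuit $\Gamma$ in $D(A)$, $(\pi_+-\pi_-)^T\tilde A=p(\Gamma)\mathbf 1^T$.
   Context: $[n]=\{1,\dots,n\}$ with addition mod $n$ (node $0$ identified with $n$); $[a,c)_n$ is the cyclic interval $\{a,\dots,c-1\}$ mod $n$. A $\{0,1\}$ $m\times n$ matrix $A$ is circular if each row $i$ is the incidence vector of $[\ell_i,\ell_i+k_i)_n$, $2\le k_i\le n-1$. $\tilde A=\binom{A}{I}$ is the $(m+n)\times n$ matrix obtained by stacking $A$ on the $n\times n$ identity. $D(A)$: node set $[n]$; forward arcs $a_i=(\ell_i-1,\ell_i+k_i-1)$ (length $k_i$), $i\in[m]$, and $a_{m+j}=(j-1,j)$ (length $1$), $j\in[n]$; reverse arcs $\bar a_i=(\ell_i+k_i-1,\ell_i-1)$ (length $-k_i$) and $\bar a_{m+j}=(j,j-1)$ (length $-1$). A circuit is a simple directed circuit; its winding number $p(\Gamma)$ satisfies $p(\Gamma)n=\sum_{a\in E(\Gamma)}l(a)$. $\pi_+\in\{0,1\}^{m+n}$ (resp. $\pi_-$) has $k$-th entry $1$ iff $a_k$ (resp. $\bar a_k$) is an arc of $\Gamma$. -}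

module Defs where

open import Data.Nat.DivMod using (m%n<n)
open import Data.Nat as ℕ using (ℕ; zero; suc; _≤_; _<_; _∸_; _%_; NonZero)
open import Data.Integer as ℤ using (ℤ; +_; 0ℤ; 1ℤ)
open import Data.Fin using (Fin; toℕ; fromℕ<)
import Data.Fin as Fin
open import Data.Fin.Properties using (any?)
import Data.Fin.Properties as FinP
open import Data.Bool using (Bool; true; false; if_then_else_)
import Data.Bool.Properties as BoolP
open import Data.Sum using (_⊎_; inj₁; inj₂)
import Data.Sum.Properties as SumP
open import Data.Product using (_×_; _,_; proj₁; proj₂; ∃)
import Data.Product.Properties as ProdP
open import Relation.Nullary using (Dec; does)
open import Relation.Binary using (DecidableEquality)
open import Relation.Binary.PropositionalEquality using (_≡_)
open import Function using (Injective)

Σℤ : (r : ℕ) → (Fin r → ℤ) → ℤ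
Σℤ zero    f = 0ℤ
Σℤ (suc r) f = f Fin.zero ℤ.+ Σℤ r (λ t → f (Fin.suc t))

-- A circular m×n matrix, given by its rows' data ℓ_i, k_i:
-- row i is the incidence vector of [ℓ_i, ℓ_i + k_i)_n,
-- with ℓ_i ∈ [n] = {1,…,n} and 2 ≤ k_i ≤ n-1.
record Circular (m n : ℕ) : Set where
  field
    ℓ   : Fin m → ℕ
    k   : Fin m → ℕ
    ℓ≥1 : ∀ i → 1 ≤ ℓ i
    ℓ≤n : ∀ i → ℓ i ≤ n
    k≥2 : ∀ i → 2 ≤ k i
    k≤n-1 : ∀ i → k i ≤ n ∸ 1

module _ {m n : ℕ} {{_ : NonZero n}} (A : Circular m n) where
  open Circular A

  -- Elements of ℤ_n are represented by their residues 0,…,n-1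
  -- (residue 0 is the node/column n of [n]).
  -- Columns of A are indexed by Fin n: column c stands for j ≡ c (mod n).

  -- j ∈ [a, a+κ)_n  iff  (j - a) mod n < κ
  inCyc : ℕ → ℕ → ℕ → Bool
  inCyc a κ j = does (((j ℕ.+ (n ∸ a % n)) % n) ℕ.<? κ)

  -- Row indices of Ã = (A ; I): inj₁ i is row i of A, inj₂ j is row m+j.
  RowIx : Set
  RowIx = Fin m ⊎ Fin n

  boolℤ : Bool → ℤ
  boolℤ true  = 1ℤ
  boolℤ false = 0ℤ

  Ã : RowIx → Fin n → ℤ
  Ã (inj₁ i) c = boolℤ (inCyc (ℓ i) (k i) (toℕ c))
  Ã (inj₂ j) c = boolℤ (does (j FinP.≟ c))

  -- Arcs of D(A): (r , true) is the forward arc a_r, (r , false) the reverse arc ā_r.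
  Arc : Set
  Arc = RowIx × Bool

  _≟Arc_ : DecidableEquality Arc
  _≟Arc_ = ProdP.≡-dec (SumP.≡-dec FinP._≟_ FinP._≟_) BoolP._≟_

  fwdTail fwdHead : RowIx → ℕ
  fwdTail (inj₁ i) = (ℓ i ℕ.+ n ∸ 1) % n
  fwdTail (inj₂ j) = (toℕ j ℕ.+ n ∸ 1) % n
  fwdHead (inj₁ i) = (ℓ i ℕ.+ k i ℕ.+ n ∸ 1) % n
  fwdHead (inj₂ j) = toℕ j

  fwdLen : RowIx → ℤ
  fwdLen (inj₁ i) = + k i
  fwdLen (inj₂ j) = 1ℤ

  tail head : Arc → ℕ
  tail (r , true)  = fwdTail r
  tail (r , false) = fwdHead r
  head (r , true)  = fwdHead r
  head (r , false) = fwdTail r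

  len : Arc → ℤ
  len (r , true)  = fwdLen r
  len (r , false) = ℤ.- fwdLen r

  nextF : {r : ℕ} → Fin (suc r) → Fin (suc r)
  nextF {r} t = fromℕ< (m%n<n (suc (toℕ t)) (suc r))

  record Circuit : Set where
    field
      r     : ℕ
      γ     : Fin (suc r) → Arc
      chain : ∀ t → head (γ t) ≡ tail (γ (nextF t))
      simple : Injective _≡_ _≡_ (λ t → tail (γ t))

  module _ (Γ : Circuit) where
    open Circuit Γ

    totalLength : ℤ
    totalLength = Σℤ (suc r) (λ t → len (γ t))

    π₊ π₋ : RowIx → ℤ
    π₊ q = boolℤ (does (any? (λ t → γ t ≟Arc (q , true))))
    π₋ q = boolℤ (does (any? (λ t → γ t ≟Arc (q , false))))

    πÃ : Fin n → ℤ
    πÃ c = Σℤ m (λ i → (π₊ (inj₁ i) ℤ.- π₋ (inj₁ i)) ℤ.* Ã (inj₁ i) c)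
           ℤ.+ Σℤ n (λ j → (π₊ (inj₂ j) ℤ.- π₋ (inj₂ j)) ℤ.* Ã (inj₂ j) c)

-- Fix a column c and put Φ(x) = x - n·[c ≤ x] on the residues x < n.  For every
-- arc a of D(A), with row q and sign ±, one has n·(±Ã_{q,c}) = l(a) + Φ(tail a) - Φ(head a):
-- the head residue is tail + |l(a)| minus n exactly when the arc wraps past 0, and
-- comparing this carry with the membership of c in the row's cyclic interval is a
-- four-case count.  As a circuit uses every arc at most once, entry c of
-- (π₊ - π₋)ᵀÃ is the sum of ±Ã_{q,c} over its arcs; summing the identity around the
-- circuit the potential telescopes, so n times that entry is Σ l(a) = p·n.

module Submission where

open import Defs
open import Data.Bool using (Bool; true; false)
open import Data.Fin using (Fin; zero; suc; toℕ; inject₁; fromℕ; punchIn)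
open import Data.Fin.Properties using (_≟_; any?; punchInᵢ≢i; 0≢1+n; suc-injective; toℕ-injective; toℕ<n; toℕ-fromℕ; toℕ-fromℕ<; toℕ-inject₁)
open import Data.Integer using (ℤ; +_; 0ℤ; 1ℤ; -1ℤ; _+_; _-_; _*_; -_)
import Data.Integer.Properties as ℤ
open import Data.Integer.Tactic.RingSolver using (solve-∀)
open import Data.Nat as ℕ using (ℕ; NonZero; _≤_; _<_; _≤?_; _<?_; _∸_; _%_; s≤s)
import Data.Nat.Properties as ℕ
open import Data.Nat.DivMod using (m<n⇒m%n≡m; [m+n]%n≡m%n; n%n≡0)
open import Data.Product using (_,_)
open import Data.Sum using (_⊎_; inj₁; inj₂)
open import Data.Sum.Properties using (inj₁-injective; inj₂-injective)
open import Function using (_∘_)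
open import Relation.Binary.PropositionalEquality
open import Relation.Nullary using (Dec; yes; no; does; ¬_)
open import Relation.Nullary.Decidable using (dec-true; dec-false)
open import Algebra.Properties.Semiring.Sum ℤ.+-*-semiring
  using (sum; sum-cong-≗; sum-replicate-zero; sum-remove; sum-init-last; ∑-comm; ∑-distrib-+; *-distribˡ-sum; *-distribʳ-sum)

open ≡-Reasoning

Σℤ≡sum : ∀ r (f : Fin r → ℤ) → Σℤ r f ≡ sum f
Σℤ≡sum ℕ.zero    f = refl
Σℤ≡sum (ℕ.suc r) f = cong (λ s → f zero + s) (Σℤ≡sum r (f ∘ suc))

sum-zero : ∀ {r} {f : Fin r → ℤ} → (∀ t → f t ≡ 0ℤ) → sum f ≡ 0ℤ
sum-zero {r} f≡0 = trans (sum-cong-≗ f≡0) (sum-replicate-zero r)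

sum-select : ∀ {r} (f : Fin r → ℤ) t₀ → (∀ t → t ≢ t₀ → f t ≡ 0ℤ) → sum f ≡ f t₀
sum-select {ℕ.suc r} f t₀ f≡0 = begin
    sum f
  ≡⟨ sum-remove f ⟩
    f t₀ + sum (λ t → f (punchIn t₀ t))
  ≡⟨ cong (λ s → f t₀ + s) (sum-zero (λ t → f≡0 _ (punchInᵢ≢i t₀ t))) ⟩
    f t₀ + 0ℤ
  ≡⟨ ℤ.+-identityʳ (f t₀) ⟩
    f t₀ ∎

sum-neg : ∀ {r} (f : Fin r → ℤ) → sum (λ t → - f t) ≡ - sum f
sum-neg f = begin
    sum (λ t → - f t)
  ≡⟨ sum-cong-≗ (λ t → sym (ℤ.-1*i≡-i (f t))) ⟩
    sum (λ t → -1ℤ * f t)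
  ≡⟨ sym (*-distribˡ-sum -1ℤ f) ⟩
    -1ℤ * sum f
  ≡⟨ ℤ.-1*i≡-i (sum f) ⟩
    - sum f ∎

sum-sub : ∀ {r} (f g : Fin r → ℤ) → sum (λ t → f t - g t) ≡ sum f - sum g
sum-sub f g = trans (∑-distrib-+ f (λ t → - g t)) (cong (λ s → sum f + s) (sum-neg g))

sum⊎ : ∀ {a b} → (Fin a ⊎ Fin b → ℤ) → ℤ
sum⊎ f = sum (f ∘ inj₁) + sum (f ∘ inj₂)

sum⊎-cong : ∀ {a b} {f g : Fin a ⊎ Fin b → ℤ} → (∀ q → f q ≡ g q) → sum⊎ f ≡ sum⊎ g
sum⊎-cong f≗g = cong₂ _+_ (sum-cong-≗ (f≗g ∘ inj₁)) (sum-cong-≗ (f≗g ∘ inj₂))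

sum⊎-comm : ∀ {a b r} (f : Fin a ⊎ Fin b → Fin r → ℤ) →
            sum⊎ (λ q → sum (f q)) ≡ sum (λ t → sum⊎ (λ q → f q t))
sum⊎-comm f = trans (cong₂ _+_ (∑-comm (f ∘ inj₁)) (∑-comm (f ∘ inj₂)))
                    (sym (∑-distrib-+ (λ t → sum (λ i → f (inj₁ i) t)) (λ t → sum (λ j → f (inj₂ j) t))))

sum⊎-select : ∀ {a b} (f : Fin a ⊎ Fin b → ℤ) q₀ → (∀ q → q ≢ q₀ → f q ≡ 0ℤ) → sum⊎ f ≡ f q₀
sum⊎-select f (inj₁ i) f≡0 = begin
    sum (f ∘ inj₁) + sum (f ∘ inj₂)
  ≡⟨ cong₂ _+_ (sum-select (f ∘ inj₁) i (λ t t≢i → f≡0 _ (t≢i ∘ inj₁-injective)))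
               (sum-zero (λ t → f≡0 (inj₂ t) λ ())) ⟩
    f (inj₁ i) + 0ℤ
  ≡⟨ ℤ.+-identityʳ _ ⟩
    f (inj₁ i) ∎
sum⊎-select f (inj₂ j) f≡0 = begin
    sum (f ∘ inj₁) + sum (f ∘ inj₂)
  ≡⟨ cong₂ _+_ (sum-zero (λ t → f≡0 (inj₁ t) λ ()))
               (sum-select (f ∘ inj₂) j (λ t t≢j → f≡0 _ (t≢j ∘ inj₂-injective))) ⟩
    0ℤ + f (inj₂ j)
  ≡⟨ ℤ.+-identityˡ _ ⟩
    f (inj₂ j) ∎

potential-step : ∀ (n κ u v i₁ i₂ i₃ i₄ : ℤ) → i₁ + i₂ ≡ i₃ + i₄ → u + κ ≡ v + n * i₃ →
                 n * i₁ ≡ κ + (u - n * i₂) - (v - n * i₄)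
potential-step n κ u v i₁ i₂ i₃ i₄ indicators carry = begin
    n * i₁
  ≡⟨ isolate n i₁ i₂ ⟩
    n * (i₁ + i₂) - n * i₂
  ≡⟨ cong (λ s → n * s - n * i₂) indicators ⟩
    n * (i₃ + i₄) - n * i₂
  ≡⟨ regroup n κ u v i₂ i₃ i₄ ⟩
    (v + n * i₃) - u + (κ + (u - n * i₂) - (v - n * i₄)) - κ
  ≡⟨ cong (λ s → s - u + (κ + (u - n * i₂) - (v - n * i₄)) - κ) (sym carry) ⟩
    (u + κ) - u + (κ + (u - n * i₂) - (v - n * i₄)) - κ
  ≡⟨ cancel u κ (κ + (u - n * i₂) - (v - n * i₄)) ⟩
    κ + (u - n * i₂) - (v - n * i₄) ∎
  where
  isolate : ∀ n x y → n * x ≡ n * (x + y) - n * y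
  isolate = solve-∀
  regroup : ∀ n κ u v i₂ i₃ i₄ →
            n * (i₃ + i₄) - n * i₂ ≡ (v + n * i₃) - u + (κ + (u - n * i₂) - (v - n * i₄)) - κ
  regroup = solve-∀
  cancel : ∀ u κ x → (u + κ) - u + x - κ ≡ x
  cancel = solve-∀

module _ {n : ℕ} {{_ : NonZero n}} where

  n∸1<n : n ∸ 1 < n
  n∸1<n = ℕ.m≤pred[n]⇒suc[m]≤n ℕ.≤-refl

  %-wrap : ∀ {x} → n ≤ x → x < n ℕ.+ n → x % n ℕ.+ n ≡ x
  %-wrap {x} n≤x x<2n = begin
      x % n ℕ.+ n
    ≡⟨ cong (λ y → y % n ℕ.+ n) (sym (ℕ.m∸n+n≡m n≤x)) ⟩
      (x ∸ n ℕ.+ n) % n ℕ.+ n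
    ≡⟨ cong (ℕ._+ n) (trans ([m+n]%n≡m%n (x ∸ n) n) (m<n⇒m%n≡m x∸n<n)) ⟩
      x ∸ n ℕ.+ n
    ≡⟨ ℕ.m∸n+n≡m n≤x ⟩
      x ∎
    where
    x∸n<n : x ∸ n < n
    x∸n<n = subst (x ∸ n <_) (ℕ.m+n∸n≡m n n) (ℕ.∸-monoˡ-< x<2n n≤x)

  -- (c + (n ∸ (u + 1) % n)) % n is the offset (c - (u + 1)) mod n computed by inCyc;
  -- adding u + 1 back lifts c into (u, u + n].
  cyclic-offset-above : ∀ {u c} → u < c → c < n → (c ℕ.+ (n ∸ ℕ.suc u % n)) % n ℕ.+ ℕ.suc u ≡ c
  cyclic-offset-above {u} {c} u<c c<n = begin
      (c ℕ.+ (n ∸ ℕ.suc u % n)) % n ℕ.+ ℕ.suc u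
    ≡⟨ cong (λ s → (c ℕ.+ (n ∸ s)) % n ℕ.+ ℕ.suc u) (m<n⇒m%n≡m (ℕ.≤-<-trans u<c c<n)) ⟩
      (c ℕ.+ (n ∸ ℕ.suc u)) % n ℕ.+ ℕ.suc u
    ≡⟨ cong (λ s → s % n ℕ.+ ℕ.suc u) shift ⟩
      (c ∸ ℕ.suc u ℕ.+ n) % n ℕ.+ ℕ.suc u
    ≡⟨ cong (ℕ._+ ℕ.suc u) (trans ([m+n]%n≡m%n (c ∸ ℕ.suc u) n) (m<n⇒m%n≡m (ℕ.≤-<-trans (ℕ.m∸n≤m c (ℕ.suc u)) c<n))) ⟩
      c ∸ ℕ.suc u ℕ.+ ℕ.suc u
    ≡⟨ ℕ.m∸n+n≡m u<c ⟩
      c ∎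
    where
    shift : c ℕ.+ (n ∸ ℕ.suc u) ≡ c ∸ ℕ.suc u ℕ.+ n
    shift = trans (sym (ℕ.+-∸-assoc c (ℕ.<-trans u<c c<n))) (ℕ.+-∸-comm n u<c)

  cyclic-offset-below : ∀ {u c} → c ≤ u → u < n → (c ℕ.+ (n ∸ ℕ.suc u % n)) % n ℕ.+ ℕ.suc u ≡ c ℕ.+ n
  cyclic-offset-below {u} {c} c≤u u<n with ℕ.m≤n⇒m<n∨m≡n u<n
  ... | inj₁ 1+u<n = begin
      (c ℕ.+ (n ∸ ℕ.suc u % n)) % n ℕ.+ ℕ.suc u
    ≡⟨ cong (λ s → (c ℕ.+ (n ∸ s)) % n ℕ.+ ℕ.suc u) (m<n⇒m%n≡m 1+u<n) ⟩
      (c ℕ.+ (n ∸ ℕ.suc u)) % n ℕ.+ ℕ.suc u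
    ≡⟨ cong (ℕ._+ ℕ.suc u) (m<n⇒m%n≡m small) ⟩
      c ℕ.+ (n ∸ ℕ.suc u) ℕ.+ ℕ.suc u
    ≡⟨ ℕ.+-assoc c (n ∸ ℕ.suc u) (ℕ.suc u) ⟩
      c ℕ.+ (n ∸ ℕ.suc u ℕ.+ ℕ.suc u)
    ≡⟨ cong (c ℕ.+_) (ℕ.m∸n+n≡m u<n) ⟩
      c ℕ.+ n ∎
    where
    small : c ℕ.+ (n ∸ ℕ.suc u) < n
    small = subst (c ℕ.+ (n ∸ ℕ.suc u) <_) (ℕ.m+[n∸m]≡n u<n) (ℕ.+-monoˡ-< (n ∸ ℕ.suc u) (s≤s c≤u))
  ... | inj₂ refl = begin
      (c ℕ.+ (n ∸ n % n)) % n ℕ.+ n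
    ≡⟨ cong (λ s → (c ℕ.+ (n ∸ s)) % n ℕ.+ n) (n%n≡0 n) ⟩
      (c ℕ.+ n) % n ℕ.+ n
    ≡⟨ cong (ℕ._+ n) (trans ([m+n]%n≡m%n c n) (m<n⇒m%n≡m (s≤s c≤u))) ⟩
      c ℕ.+ n ∎

module _ {m n : ℕ} {{_ : NonZero n}} (A : Circular m n) where
  open Circular A

  ⟦_⟧ : {P : Set} → Dec P → ℤ
  ⟦ P? ⟧ = boolℤ A (does P?)

  ⟦⟧-true : ∀ {P} (P? : Dec P) → P → ⟦ P? ⟧ ≡ 1ℤ
  ⟦⟧-true P? p = cong (boolℤ A) (dec-true P? p)

  ⟦⟧-false : ∀ {P} (P? : Dec P) → ¬ P → ⟦ P? ⟧ ≡ 0ℤ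
  ⟦⟧-false P? ¬p = cong (boolℤ A) (dec-false P? ¬p)

  ⟦⟧-cong : ∀ {P Q} (P? : Dec P) (Q? : Dec Q) → (P → Q) → (Q → P) → ⟦ P? ⟧ ≡ ⟦ Q? ⟧
  ⟦⟧-cong (yes p)  Q? P→Q Q→P = sym (⟦⟧-true Q? (P→Q p))
  ⟦⟧-cong (no ¬p) Q? P→Q Q→P = sym (⟦⟧-false Q? (¬p ∘ Q→P))

  Φ : ℕ → ℕ → ℤ
  Φ C x = + x - + n * ⟦ C ≤? x ⟧

  mod-carry : ∀ x → x < n ℕ.+ n → + x ≡ + (x % n) + + n * ⟦ n ≤? x ⟧
  mod-carry x x<2n with n ≤? x
  ... | yes n≤x = begin
      + x
    ≡⟨ cong +_ (sym (%-wrap n≤x x<2n)) ⟩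
      + (x % n ℕ.+ n)
    ≡⟨ ℤ.pos-+ (x % n) n ⟩
      + (x % n) + + n
    ≡⟨ cong (λ s → + (x % n) + s) (sym (ℤ.*-identityʳ (+ n))) ⟩
      + (x % n) + + n * 1ℤ
    ≡⟨ cong (λ s → + (x % n) + + n * s) (sym (⟦⟧-true (n ≤? x) n≤x)) ⟩
      + (x % n) + + n * ⟦ n ≤? x ⟧ ∎
  ... | no n≰x = begin
      + x
    ≡⟨ cong +_ (sym (m<n⇒m%n≡m (ℕ.≰⇒> n≰x))) ⟩
      + (x % n)
    ≡⟨ sym (ℤ.+-identityʳ _) ⟩
      + (x % n) + 0ℤ
    ≡⟨ cong (λ s → + (x % n) + s) (sym (ℤ.*-zeroʳ (+ n))) ⟩
      + (x % n) + + n * 0ℤ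
    ≡⟨ cong (λ s → + (x % n) + + n * s) (sym (⟦⟧-false (n ≤? x) n≰x)) ⟩
      + (x % n) + + n * ⟦ n ≤? x ⟧ ∎

  arc-potential : ∀ {κ u v} C (b : Bool) → u < n → κ ≤ n → (u ℕ.+ κ) % n ≡ v →
    boolℤ A b + ⟦ C ≤? u ⟧ ≡ ⟦ n ≤? u ℕ.+ κ ⟧ + ⟦ C ≤? v ⟧ →
    + n * boolℤ A b ≡ + κ + Φ C u - Φ C v
  arc-potential {κ} {u} {v} C b u<n κ≤n u+κ%n≡v indicators =
    potential-step (+ n) (+ κ) (+ u) (+ v) _ _ _ _ indicators (begin
        + u + + κ
      ≡⟨ sym (ℤ.pos-+ u κ) ⟩
        + (u ℕ.+ κ)
      ≡⟨ mod-carry (u ℕ.+ κ) (ℕ.+-mono-<-≤ u<n κ≤n) ⟩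
        + ((u ℕ.+ κ) % n) + + n * ⟦ n ≤? u ℕ.+ κ ⟧
      ≡⟨ cong (λ w → + w + + n * ⟦ n ≤? u ℕ.+ κ ⟧) u+κ%n≡v ⟩
        + v + + n * ⟦ n ≤? u ℕ.+ κ ⟧ ∎)

  lift-indicator-below : ∀ {u κ C y} → u < n → κ < n → C ≤ u → y ≡ C ℕ.+ n →
    ⟦ y ≤? u ℕ.+ κ ⟧ + ⟦ C ≤? u ⟧ ≡ ⟦ n ≤? u ℕ.+ κ ⟧ + ⟦ C ≤? (u ℕ.+ κ) % n ⟧
  lift-indicator-below {u} {κ} {C} {y} u<n κ<n C≤u y≡C+n with n ≤? u ℕ.+ κ
  ... | yes wraps = begin
      ⟦ y ≤? u ℕ.+ κ ⟧ + ⟦ C ≤? u ⟧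
    ≡⟨ cong₂ _+_ (⟦⟧-cong (y ≤? u ℕ.+ κ) (C ≤? v) y≤→C≤v C≤v→y≤) (⟦⟧-true (C ≤? u) C≤u) ⟩
      ⟦ C ≤? v ⟧ + 1ℤ
    ≡⟨ ℤ.+-comm ⟦ C ≤? v ⟧ 1ℤ ⟩
      1ℤ + ⟦ C ≤? v ⟧
    ≡⟨ cong₂ _+_ (sym (⟦⟧-true (n ≤? u ℕ.+ κ) wraps)) refl ⟩
      ⟦ n ≤? u ℕ.+ κ ⟧ + ⟦ C ≤? v ⟧ ∎
    where
    v = (u ℕ.+ κ) % n
    v+n≡u+κ : v ℕ.+ n ≡ u ℕ.+ κ
    v+n≡u+κ = %-wrap wraps (ℕ.+-mono-< u<n κ<n)
    y≤→C≤v : y ≤ u ℕ.+ κ → C ≤ v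
    y≤→C≤v y≤ = ℕ.+-cancelʳ-≤ n C v (subst₂ _≤_ y≡C+n (sym v+n≡u+κ) y≤)
    C≤v→y≤ : C ≤ v → y ≤ u ℕ.+ κ
    C≤v→y≤ C≤v = subst₂ _≤_ (sym y≡C+n) v+n≡u+κ (ℕ.+-monoˡ-≤ n C≤v)
  ... | no ¬wraps = begin
      ⟦ y ≤? u ℕ.+ κ ⟧ + ⟦ C ≤? u ⟧
    ≡⟨ cong₂ _+_ (⟦⟧-false (y ≤? u ℕ.+ κ) y≰u+κ) (⟦⟧-true (C ≤? u) C≤u) ⟩
      0ℤ + 1ℤ
    ≡⟨ cong₂ _+_ (sym (⟦⟧-false (n ≤? u ℕ.+ κ) ¬wraps)) (sym (⟦⟧-true (C ≤? v) C≤v)) ⟩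
      ⟦ n ≤? u ℕ.+ κ ⟧ + ⟦ C ≤? v ⟧ ∎
    where
    v = (u ℕ.+ κ) % n
    y≰u+κ : ¬ y ≤ u ℕ.+ κ
    y≰u+κ y≤ = ¬wraps (ℕ.≤-trans (ℕ.m≤n+m n C) (subst (_≤ u ℕ.+ κ) y≡C+n y≤))
    C≤v : C ≤ v
    C≤v = subst (C ≤_) (sym (m<n⇒m%n≡m (ℕ.≰⇒> ¬wraps))) (ℕ.≤-trans C≤u (ℕ.m≤m+n u κ))

  lift-indicator-above : ∀ {u κ C y} → u < n → κ < n → C < n → u < C → y ≡ C →
    ⟦ y ≤? u ℕ.+ κ ⟧ + ⟦ C ≤? u ⟧ ≡ ⟦ n ≤? u ℕ.+ κ ⟧ + ⟦ C ≤? (u ℕ.+ κ) % n ⟧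
  lift-indicator-above {u} {κ} {C} {y} u<n κ<n C<n u<C y≡C with n ≤? u ℕ.+ κ
  ... | yes wraps = begin
      ⟦ y ≤? u ℕ.+ κ ⟧ + ⟦ C ≤? u ⟧
    ≡⟨ cong₂ _+_ (⟦⟧-true (y ≤? u ℕ.+ κ) y≤u+κ) (⟦⟧-false (C ≤? u) (ℕ.<⇒≱ u<C)) ⟩
      1ℤ + 0ℤ
    ≡⟨ cong₂ _+_ (sym (⟦⟧-true (n ≤? u ℕ.+ κ) wraps)) (sym (⟦⟧-false (C ≤? v) (ℕ.<⇒≱ (ℕ.<-trans v<u u<C)))) ⟩
      ⟦ n ≤? u ℕ.+ κ ⟧ + ⟦ C ≤? v ⟧ ∎
    where
    v = (u ℕ.+ κ) % n
    y≤u+κ : y ≤ u ℕ.+ κ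
    y≤u+κ = subst (_≤ u ℕ.+ κ) (sym y≡C) (ℕ.≤-trans (ℕ.<⇒≤ C<n) wraps)
    v<u : v < u
    v<u = ℕ.+-cancelʳ-< n v u
            (subst (_< u ℕ.+ n) (sym (%-wrap wraps (ℕ.+-mono-< u<n κ<n))) (ℕ.+-monoʳ-< u κ<n))
  ... | no ¬wraps = begin
      ⟦ y ≤? u ℕ.+ κ ⟧ + ⟦ C ≤? u ⟧
    ≡⟨ cong₂ _+_ (⟦⟧-cong (y ≤? u ℕ.+ κ) (C ≤? v) (subst₂ _≤_ y≡C (sym v≡u+κ)) (subst₂ _≤_ (sym y≡C) v≡u+κ))
                 (⟦⟧-false (C ≤? u) (ℕ.<⇒≱ u<C)) ⟩
      ⟦ C ≤? v ⟧ + 0ℤ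
    ≡⟨ ℤ.+-comm ⟦ C ≤? v ⟧ 0ℤ ⟩
      0ℤ + ⟦ C ≤? v ⟧
    ≡⟨ cong₂ _+_ (sym (⟦⟧-false (n ≤? u ℕ.+ κ) ¬wraps)) refl ⟩
      ⟦ n ≤? u ℕ.+ κ ⟧ + ⟦ C ≤? v ⟧ ∎
    where
    v = (u ℕ.+ κ) % n
    v≡u+κ : v ≡ u ℕ.+ κ
    v≡u+κ = m<n⇒m%n≡m (ℕ.≰⇒> ¬wraps)

  -- y is the representative of the column C in (u, u + n], so C lies in the
  -- cyclic interval (u, u + κ] iff y ≤ u + κ.
  lift-indicator : ∀ {u κ C y} → u < n → κ < n → C < n →
                   (C ≤ u → y ≡ C ℕ.+ n) → (u < C → y ≡ C) →
                   ⟦ y ≤? u ℕ.+ κ ⟧ + ⟦ C ≤? u ⟧ ≡ ⟦ n ≤? u ℕ.+ κ ⟧ + ⟦ C ≤? (u ℕ.+ κ) % n ⟧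
  lift-indicator {u} {κ} {C} u<n κ<n C<n below above with C ≤? u
  ... | yes C≤u = lift-indicator-below u<n κ<n C≤u (below C≤u)
  ... | no C≰u  = lift-indicator-above u<n κ<n C<n (ℕ.≰⇒> C≰u) (above (ℕ.≰⇒> C≰u))

  circular-indicator : ∀ {u κ} (c : Fin n) → u < n → κ < n →
    boolℤ A (inCyc A (ℕ.suc u) κ (toℕ c)) + ⟦ toℕ c ≤? u ⟧
      ≡ ⟦ n ≤? u ℕ.+ κ ⟧ + ⟦ toℕ c ≤? (u ℕ.+ κ) % n ⟧
  circular-indicator {u} {κ} c u<n κ<n = begin
      ⟦ W <? κ ⟧ + ⟦ toℕ c ≤? u ⟧
    ≡⟨ cong₂ _+_ (⟦⟧-cong (W <? κ) (W ℕ.+ ℕ.suc u ≤? u ℕ.+ κ) W<κ→lift≤ lift≤→W<κ) refl ⟩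
      ⟦ W ℕ.+ ℕ.suc u ≤? u ℕ.+ κ ⟧ + ⟦ toℕ c ≤? u ⟧
    ≡⟨ lift-indicator u<n κ<n (toℕ<n c) (λ c≤u → cyclic-offset-below c≤u u<n) (λ u<c → cyclic-offset-above u<c (toℕ<n c)) ⟩
      ⟦ n ≤? u ℕ.+ κ ⟧ + ⟦ toℕ c ≤? (u ℕ.+ κ) % n ⟧ ∎
    where
    W = (toℕ c ℕ.+ (n ∸ ℕ.suc u % n)) % n
    W<κ→lift≤ : W < κ → W ℕ.+ ℕ.suc u ≤ u ℕ.+ κ
    W<κ→lift≤ W<κ = subst₂ _≤_ (sym (ℕ.+-suc W u)) (ℕ.+-comm κ u) (ℕ.+-monoˡ-≤ u W<κ)
    lift≤→W<κ : W ℕ.+ ℕ.suc u ≤ u ℕ.+ κ → W < κ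
    lift≤→W<κ W+1+u≤ = ℕ.+-cancelʳ-≤ u (ℕ.suc W) κ (subst₂ _≤_ (ℕ.+-suc W u) (ℕ.+-comm u κ) W+1+u≤)

  circular-row-potential : ∀ ℓ κ (c : Fin n) → 1 ≤ ℓ → ℓ ≤ n → κ < n →
    + n * boolℤ A (inCyc A ℓ κ (toℕ c))
      ≡ + κ + Φ (toℕ c) ((ℓ ℕ.+ n ∸ 1) % n) - Φ (toℕ c) ((ℓ ℕ.+ κ ℕ.+ n ∸ 1) % n)
  circular-row-potential (ℕ.suc u) κ c _ u<n κ<n = begin
      + n * boolℤ A (inCyc A (ℕ.suc u) κ (toℕ c))
    ≡⟨ arc-potential (toℕ c) _ u<n (ℕ.<⇒≤ κ<n) refl (circular-indicator c u<n κ<n) ⟩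
      + κ + Φ (toℕ c) u - Φ (toℕ c) ((u ℕ.+ κ) % n)
    ≡⟨ cong₂ (λ x y → + κ + Φ (toℕ c) x - Φ (toℕ c) y)
         (sym (trans ([m+n]%n≡m%n u n) (m<n⇒m%n≡m u<n))) (sym ([m+n]%n≡m%n (u ℕ.+ κ) n)) ⟩
      + κ + Φ (toℕ c) ((u ℕ.+ n) % n) - Φ (toℕ c) ((u ℕ.+ κ ℕ.+ n) % n) ∎

  ≤-suc-indicator : ∀ C J → ⟦ ℕ.suc J ℕ.≟ C ⟧ + ⟦ C ≤? J ⟧ ≡ ⟦ C ≤? ℕ.suc J ⟧
  ≤-suc-indicator C J with C ≤? J
  ... | yes C≤J = begin
      ⟦ ℕ.suc J ℕ.≟ C ⟧ + ⟦ C ≤? J ⟧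
    ≡⟨ cong₂ _+_ (⟦⟧-false (ℕ.suc J ℕ.≟ C) (λ 1+J≡C → ℕ.<-irrefl refl (subst (_≤ J) (sym 1+J≡C) C≤J)))
                 (⟦⟧-true (C ≤? J) C≤J) ⟩
      0ℤ + 1ℤ
    ≡⟨ sym (⟦⟧-true (C ≤? ℕ.suc J) (ℕ.m≤n⇒m≤1+n C≤J)) ⟩
      ⟦ C ≤? ℕ.suc J ⟧ ∎
  ... | no C≰J = begin
      ⟦ ℕ.suc J ℕ.≟ C ⟧ + ⟦ C ≤? J ⟧
    ≡⟨ cong₂ _+_ (⟦⟧-cong (ℕ.suc J ℕ.≟ C) (C ≤? ℕ.suc J) (λ 1+J≡C → ℕ.≤-reflexive (sym 1+J≡C))
                            (ℕ.≤-antisym (ℕ.≰⇒> C≰J)))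
                 (⟦⟧-false (C ≤? J) C≰J) ⟩
      ⟦ C ≤? ℕ.suc J ⟧ + 0ℤ
    ≡⟨ ℤ.+-identityʳ _ ⟩
      ⟦ C ≤? ℕ.suc J ⟧ ∎

  -- The identity row J is the arc (J - 1, J) of length 1; it wraps past 0 exactly when J = 0.
  unit-row-potential : ∀ J C → J < n → C < n →
    + n * ⟦ J ℕ.≟ C ⟧ ≡ 1ℤ + Φ C ((J ℕ.+ n ∸ 1) % n) - Φ C J
  unit-row-potential ℕ.zero C _ C<n = begin
      + n * ⟦ 0 ℕ.≟ C ⟧
    ≡⟨ arc-potential C _ n∸1<n (ℕ.>-nonZero⁻¹ n) n∸1+1%n≡0 indicators ⟩
      1ℤ + Φ C (n ∸ 1) - Φ C 0
    ≡⟨ cong (λ x → 1ℤ + Φ C x - Φ C 0) (sym (m<n⇒m%n≡m n∸1<n)) ⟩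
      1ℤ + Φ C ((n ∸ 1) % n) - Φ C 0 ∎
    where
    n∸1+1≡n : n ∸ 1 ℕ.+ 1 ≡ n
    n∸1+1≡n = ℕ.m∸n+n≡m (ℕ.>-nonZero⁻¹ n)
    n∸1+1%n≡0 : (n ∸ 1 ℕ.+ 1) % n ≡ 0
    n∸1+1%n≡0 = trans (cong (_% n) n∸1+1≡n) (n%n≡0 n)
    wraps : n ≤ n ∸ 1 ℕ.+ 1
    wraps = ℕ.≤-reflexive (sym n∸1+1≡n)
    indicators : ⟦ 0 ℕ.≟ C ⟧ + ⟦ C ≤? n ∸ 1 ⟧ ≡ ⟦ n ≤? n ∸ 1 ℕ.+ 1 ⟧ + ⟦ C ≤? 0 ⟧
    indicators = begin
        ⟦ 0 ℕ.≟ C ⟧ + ⟦ C ≤? n ∸ 1 ⟧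
      ≡⟨ cong₂ _+_ (⟦⟧-cong (0 ℕ.≟ C) (C ≤? 0) (λ 0≡C → ℕ.≤-reflexive (sym 0≡C)) (sym ∘ ℕ.n≤0⇒n≡0))
                   (⟦⟧-true (C ≤? n ∸ 1) (ℕ.suc[m]≤n⇒m≤pred[n] C<n)) ⟩
        ⟦ C ≤? 0 ⟧ + 1ℤ
      ≡⟨ ℤ.+-comm ⟦ C ≤? 0 ⟧ 1ℤ ⟩
        1ℤ + ⟦ C ≤? 0 ⟧
      ≡⟨ cong₂ _+_ (sym (⟦⟧-true (n ≤? n ∸ 1 ℕ.+ 1) wraps)) refl ⟩
        ⟦ n ≤? n ∸ 1 ℕ.+ 1 ⟧ + ⟦ C ≤? 0 ⟧ ∎
  unit-row-potential (ℕ.suc J) C 1+J<n C<n = begin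
      + n * ⟦ ℕ.suc J ℕ.≟ C ⟧
    ≡⟨ arc-potential C _ J<n (ℕ.>-nonZero⁻¹ n) J+1%n≡1+J indicators ⟩
      1ℤ + Φ C J - Φ C (ℕ.suc J)
    ≡⟨ cong (λ x → 1ℤ + Φ C x - Φ C (ℕ.suc J)) (sym (trans ([m+n]%n≡m%n J n) (m<n⇒m%n≡m J<n))) ⟩
      1ℤ + Φ C ((J ℕ.+ n) % n) - Φ C (ℕ.suc J) ∎
    where
    J<n = ℕ.<-trans (ℕ.n<1+n J) 1+J<n
    J+1≡1+J : J ℕ.+ 1 ≡ ℕ.suc J
    J+1≡1+J = ℕ.+-comm J 1
    J+1%n≡1+J : (J ℕ.+ 1) % n ≡ ℕ.suc J
    J+1%n≡1+J = trans (cong (_% n) J+1≡1+J) (m<n⇒m%n≡m 1+J<n)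
    no-wrap : ¬ n ≤ J ℕ.+ 1
    no-wrap n≤ = ℕ.<⇒≱ 1+J<n (subst (n ≤_) J+1≡1+J n≤)
    indicators : ⟦ ℕ.suc J ℕ.≟ C ⟧ + ⟦ C ≤? J ⟧ ≡ ⟦ n ≤? J ℕ.+ 1 ⟧ + ⟦ C ≤? ℕ.suc J ⟧
    indicators = begin
        ⟦ ℕ.suc J ℕ.≟ C ⟧ + ⟦ C ≤? J ⟧
      ≡⟨ ≤-suc-indicator C J ⟩
        ⟦ C ≤? ℕ.suc J ⟧
      ≡⟨ sym (ℤ.+-identityˡ _) ⟩
        0ℤ + ⟦ C ≤? ℕ.suc J ⟧
      ≡⟨ cong₂ _+_ (sym (⟦⟧-false (n ≤? J ℕ.+ 1) no-wrap)) refl ⟩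
        ⟦ n ≤? J ℕ.+ 1 ⟧ + ⟦ C ≤? ℕ.suc J ⟧ ∎

  forward-potential : ∀ q (c : Fin n) →
    + n * Ã A q c ≡ fwdLen A q + Φ (toℕ c) (fwdTail A q) - Φ (toℕ c) (fwdHead A q)
  forward-potential (inj₁ i) c =
    circular-row-potential (ℓ i) (k i) c (ℓ≥1 i) (ℓ≤n i) (ℕ.≤-<-trans (k≤n-1 i) n∸1<n)
  forward-potential (inj₂ j) c =
    trans (cong (+ n *_) (⟦⟧-cong (j ≟ c) (toℕ j ℕ.≟ toℕ c) (cong toℕ) toℕ-injective))
          (unit-row-potential (toℕ j) (toℕ c) (toℕ<n j) (toℕ<n c))

  orientation : Bool → ℤ
  orientation true  = 1ℤ
  orientation false = -1ℤ

  signedRow : Arc A → Fin n → ℤ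
  signedRow (q , b) c = orientation b * Ã A q c

  signedRow-potential : ∀ a (c : Fin n) →
    + n * signedRow a c ≡ len A a + Φ (toℕ c) (tail A a) - Φ (toℕ c) (head A a)
  signedRow-potential (q , true)  c = trans (cong (+ n *_) (ℤ.*-identityˡ (Ã A q c))) (forward-potential q c)
  signedRow-potential (q , false) c = begin
      + n * (-1ℤ * Ã A q c)
    ≡⟨ negate (+ n) (Ã A q c) ⟩
      - (+ n * Ã A q c)
    ≡⟨ cong -_ (forward-potential q c) ⟩
      - (fwdLen A q + T - H)
    ≡⟨ reverse (fwdLen A q) T H ⟩
      - fwdLen A q + H - T ∎
    where
    T = Φ (toℕ c) (fwdTail A q)
    H = Φ (toℕ c) (fwdHead A q)
    negate : ∀ x y → x * (-1ℤ * y) ≡ - (x * y)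
    negate = solve-∀
    reverse : ∀ l t h → - (l + t - h) ≡ - l + h - t
    reverse = solve-∀

  ⟦any?⟧≡sum : ∀ {r} {P : Fin r → Set} (P? : ∀ t → Dec (P t)) →
               (∀ {s t} → P s → P t → s ≡ t) → ⟦ any? P? ⟧ ≡ sum (λ t → ⟦ P? t ⟧)
  ⟦any?⟧≡sum {ℕ.zero}  P? unique = refl
  ⟦any?⟧≡sum {ℕ.suc r} P? unique with P? zero
  ... | yes p = cong (λ s → 1ℤ + s)
                  (sym (sum-zero (λ t → ⟦⟧-false (P? (suc t)) (λ q → 0≢1+n (unique p q)))))
  ... | no _  = trans (⟦any?⟧≡sum (P? ∘ suc) (λ p q → suc-injective (unique p q)))
                      (sym (ℤ.+-identityˡ _))

  incidence : Arc A → RowIx A → ℤ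
  incidence a q = ⟦ _≟Arc_ A a (q , true) ⟧ - ⟦ _≟Arc_ A a (q , false) ⟧

  incidence-self : ∀ q b → incidence (q , b) q ≡ orientation b
  incidence-self q true  = cong₂ _-_ (⟦⟧-true (_≟Arc_ A (q , true) (q , true)) refl)
                                     (⟦⟧-false (_≟Arc_ A (q , true) (q , false)) λ ())
  incidence-self q false = cong₂ _-_ (⟦⟧-false (_≟Arc_ A (q , false) (q , true)) λ ())
                                     (⟦⟧-true (_≟Arc_ A (q , false) (q , false)) refl)

  incidence-other : ∀ {q₀ q} b → q ≢ q₀ → incidence (q₀ , b) q ≡ 0ℤ
  incidence-other {q₀} {q} b q≢q₀ =
    cong₂ _-_ (⟦⟧-false (_≟Arc_ A (q₀ , b) (q , true)) (λ { refl → q≢q₀ refl }))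
              (⟦⟧-false (_≟Arc_ A (q₀ , b) (q , false)) (λ { refl → q≢q₀ refl }))

  sum-incidence : ∀ a (c : Fin n) → sum⊎ (λ q → incidence a q * Ã A q c) ≡ signedRow a c
  sum-incidence (q₀ , b) c = begin
      sum⊎ (λ q → incidence (q₀ , b) q * Ã A q c)
    ≡⟨ sum⊎-select (λ q → incidence (q₀ , b) q * Ã A q c) q₀ (λ q q≢q₀ → trans (cong (_* Ã A q c) (incidence-other b q≢q₀)) (ℤ.*-zeroˡ (Ã A q c))) ⟩
      incidence (q₀ , b) q₀ * Ã A q₀ c
    ≡⟨ cong (_* Ã A q₀ c) (incidence-self q₀ b) ⟩
      orientation b * Ã A q₀ c ∎

  nextF-inject₁ : ∀ {r} (t : Fin r) → nextF A (inject₁ t) ≡ suc t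
  nextF-inject₁ {r} t = toℕ-injective (begin
      toℕ (nextF A (inject₁ t))
    ≡⟨ toℕ-fromℕ< _ ⟩
      ℕ.suc (toℕ (inject₁ t)) % ℕ.suc r
    ≡⟨ cong (λ x → ℕ.suc x % ℕ.suc r) (toℕ-inject₁ t) ⟩
      ℕ.suc (toℕ t) % ℕ.suc r
    ≡⟨ m<n⇒m%n≡m (s≤s (toℕ<n t)) ⟩
      ℕ.suc (toℕ t) ∎)

  nextF-fromℕ : ∀ r → nextF A (fromℕ r) ≡ zero
  nextF-fromℕ r = toℕ-injective (begin
      toℕ (nextF A (fromℕ r))
    ≡⟨ toℕ-fromℕ< _ ⟩
      ℕ.suc (toℕ (fromℕ r)) % ℕ.suc r
    ≡⟨ cong (λ x → ℕ.suc x % ℕ.suc r) (toℕ-fromℕ r) ⟩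
      ℕ.suc r % ℕ.suc r
    ≡⟨ n%n≡0 (ℕ.suc r) ⟩
      0 ∎)

  sum-nextF : ∀ {r} (f : Fin (ℕ.suc r) → ℤ) → sum (f ∘ nextF A) ≡ sum f
  sum-nextF {r} f = begin
      sum (f ∘ nextF A)
    ≡⟨ sum-init-last (f ∘ nextF A) ⟩
      sum (λ t → f (nextF A (inject₁ t))) + f (nextF A (fromℕ r))
    ≡⟨ cong₂ _+_ (sum-cong-≗ (cong f ∘ nextF-inject₁)) (cong f (nextF-fromℕ r)) ⟩
      sum (f ∘ suc) + f zero
    ≡⟨ ℤ.+-comm (sum (f ∘ suc)) (f zero) ⟩
      sum f ∎

  module _ (Γ : Circuit A) where
    open Circuit Γ

    arc-visited-once : ∀ {x s t} → γ s ≡ x → γ t ≡ x → s ≡ t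
    arc-visited-once γs≡x γt≡x = simple (cong (tail A) (trans γs≡x (sym γt≡x)))

    π₊-π₋≡sum-incidence : ∀ q → π₊ A Γ q - π₋ A Γ q ≡ sum (λ t → incidence (γ t) q)
    π₊-π₋≡sum-incidence q = begin
        π₊ A Γ q - π₋ A Γ q
      ≡⟨ cong₂ _-_ (⟦any?⟧≡sum (λ t → _≟Arc_ A (γ t) (q , true)) arc-visited-once)
                   (⟦any?⟧≡sum (λ t → _≟Arc_ A (γ t) (q , false)) arc-visited-once) ⟩
        sum (λ t → ⟦ _≟Arc_ A (γ t) (q , true) ⟧) - sum (λ t → ⟦ _≟Arc_ A (γ t) (q , false) ⟧)
      ≡⟨ sym (sum-sub (λ t → ⟦ _≟Arc_ A (γ t) (q , true) ⟧) (λ t → ⟦ _≟Arc_ A (γ t) (q , false) ⟧)) ⟩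
        sum (λ t → incidence (γ t) q) ∎

    πÃ≡sum-signedRow : ∀ c → πÃ A Γ c ≡ sum (λ t → signedRow (γ t) c)
    πÃ≡sum-signedRow c = begin
        πÃ A Γ c
      ≡⟨ cong₂ _+_ (Σℤ≡sum m _) (Σℤ≡sum n _) ⟩
        sum⊎ (λ q → (π₊ A Γ q - π₋ A Γ q) * Ã A q c)
      ≡⟨ sum⊎-cong (λ q → cong (_* Ã A q c) (π₊-π₋≡sum-incidence q)) ⟩
        sum⊎ (λ q → sum (λ t → incidence (γ t) q) * Ã A q c)
      ≡⟨ sum⊎-cong (λ q → *-distribʳ-sum (Ã A q c) (λ t → incidence (γ t) q)) ⟩
        sum⊎ (λ q → sum (λ t → incidence (γ t) q * Ã A q c))
      ≡⟨ sum⊎-comm (λ q t → incidence (γ t) q * Ã A q c) ⟩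
        sum (λ t → sum⊎ (λ q → incidence (γ t) q * Ã A q c))
      ≡⟨ sum-cong-≗ (λ t → sum-incidence (γ t) c) ⟩
        sum (λ t → signedRow (γ t) c) ∎

    n*πÃ≡totalLength : ∀ c → + n * πÃ A Γ c ≡ totalLength A Γ
    n*πÃ≡totalLength c = begin
        + n * πÃ A Γ c
      ≡⟨ cong (+ n *_) (πÃ≡sum-signedRow c) ⟩
        + n * sum (λ t → signedRow (γ t) c)
      ≡⟨ *-distribˡ-sum (+ n) (λ t → signedRow (γ t) c) ⟩
        sum (λ t → + n * signedRow (γ t) c)
      ≡⟨ sum-cong-≗ (λ t → signedRow-potential (γ t) c) ⟩
        sum (λ t → len A (γ t) + Φ C (tail A (γ t)) - Φ C (head A (γ t)))
      ≡⟨ sum-sub (λ t → len A (γ t) + Φ C (tail A (γ t))) (λ t → Φ C (head A (γ t))) ⟩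
        sum (λ t → len A (γ t) + Φ C (tail A (γ t))) - sum (λ t → Φ C (head A (γ t)))
      ≡⟨ cong₂ _-_ (∑-distrib-+ (λ t → len A (γ t)) (λ t → Φ C (tail A (γ t)))) telescope ⟩
        sum (λ t → len A (γ t)) + sum (λ t → Φ C (tail A (γ t))) - sum (λ t → Φ C (tail A (γ t)))
      ≡⟨ cancel (sum (λ t → len A (γ t))) (sum (λ t → Φ C (tail A (γ t)))) ⟩
        sum (λ t → len A (γ t))
      ≡⟨ sym (Σℤ≡sum (ℕ.suc r) (λ t → len A (γ t))) ⟩
        totalLength A Γ ∎
      where
      C = toℕ c
      telescope : sum (λ t → Φ C (head A (γ t))) ≡ sum (λ t → Φ C (tail A (γ t)))
      telescope = trans (sum-cong-≗ (λ t → cong (Φ C) (chain t))) (sum-nextF (λ t → Φ C (tail A (γ t))))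
      cancel : ∀ x y → x + y - y ≡ x
      cancel = solve-∀

corollary4p2 : {m n : ℕ} {{_ : NonZero n}} (A : Circular m n) (Γ : Circuit A)
    → (p : ℤ) → p * + n ≡ totalLength A Γ
    → (c : Fin n) → πÃ A Γ c ≡ p
corollary4p2 {n = n} A Γ p p*n≡total c = ℤ.*-cancelˡ-≡ (+ n) (πÃ A Γ c) p (begin
    + n * πÃ A Γ c
  ≡⟨ n*πÃ≡totalLength A Γ c ⟩
    totalLength A Γ
  ≡⟨ sym p*n≡total ⟩
    p * + n
  ≡⟨ ℤ.*-comm p (+ n) ⟩
    + n * p ∎)
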